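{- Let $J$ be a non-trivial model of $\mathrm{FEA}(L)$, and let $Q$ and $Q'$ be consistent queries in solved form. If $Q\preceq_J Q'$, then $\mathrm{vars}(Q)\supseteq\mathrm{vars}(Q')$.
   Context: $L$ is a first-order language with equality whose function symbols include at least one constant. $\mathrm{FEA}(L)$ (free equality axioms): $f(\bar x)=f(\bar y)\leftrightarrow x_1=y_1\wedge\dots\wedge x_n=y_n$ for each $n$-ary $f$; $f(\bar x)=g(\bar y)\leftrightarrow\mathit{False}$ for distinct $f,g$; $x=t\leftrightarrow\mathit{False}$ whenever $x\not\equiv t$ occurs in $t$. A pre-interpretation $J$: nonempty domain $U_J$, interpretation of function symbols, $=$ identity; $V_J$ the set of $J$-valuations; $J$ is a non-trivial model of $\mathrm{FEA}(L)$ if the axioms hold in $J$ and $|U_J|\ge2$. Interpretations based on $J$ are subsets of the $J$-base (all $p(d_1,\dots,d_n)$, $p$ non-equality predicate, $d_i\in U_J$); a multiinterpretation is a finite sequence of them. A query is built from $\mathit{True}$, $\mathit{False}$, equations and atoms using only $\wedge,\exists$; $|Q|$ = number of atom occurrences; $\mathrm{vars}(Q)$ = set of free variables. $\mathrm{Sol}_J(Q,\bar I)$ for $|\bar I|=|Q|$: $V_J$ for $\mathit{True}$, $\emptyset$ for $\mathit{False}$, $\{h:h(s)=h(t)\}$ for $s=t$, $\{h:h(A)\in I\}$ for atom $A$ with $(I)$, intersection for $Q_1\wedge Q_2$ with $\bar I_1\bar I_2$ split by $|Q_1|,|Q_2|$, and $\{h: h[x\mapsto d]\in\mathrm{Sol}_J(Q,\bar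 I)$ for some $d\}$ for $(\exists x)Q$. $Q\preceq_J Q'$ iff $|Q|=|Q'|$ and $\mathrm{Sol}_J(Q,\bar I)\subseteq\mathrm{Sol}_J(Q',\bar I)$ for all $\bar I$ of length $|Q|$ based on $J$. Solved form: $\mathit{True}$, $\mathit{False}$, or $(\exists z_1)\dots(\exists z_k)(x_1=s_1\wedge\dots\wedge x_n=s_n\wedge A_1\wedge\dots\wedge A_m)$ with the $x_i,z_j$ pairwise distinct variables, no $x_i$ in any $s_j$ or atom, each $z_j$ occurring in the conjunction, $z_j\not\equiv s_i$. $Q$ is consistent if $\mathrm{FEA}(L)\not\models\neg Q$. -}

module Defs where

open import Data.Nat using (ℕ; zero; suc; _+_; _≟_)
open import Data.Bool using (if_then_else_)
open import Data.Product using (Σ; ∃; _×_; _,_; proj₁; proj₂)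
open import Data.List using (List; []; _∷_; _++_; map; foldr)
open import Data.List.Membership.Propositional using (_∈_)
open import Data.List.Relation.Unary.Unique.Propositional using (Unique)
open import Data.Vec using (Vec; []; _∷_; take; drop)
open import Data.Vec.Relation.Unary.Any using (Any)
open import Data.Empty using (⊥)
open import Data.Unit using (⊤)
open import Relation.Nullary using (¬_; does)
open import Relation.Binary.PropositionalEquality using (_≡_; subst)

-- First-order language with equality (equality is built in, not a
-- predicate symbol).  Variables are natural numbers.

record Language : Set₁ where
  field
    F      : Set
    arity  : F → ℕ
    P      : Set
    parity : P → ℕ
    hasConstant : Σ F (λ c → arity c ≡ 0)

open Language

Var : Set
Var = ℕ

data Term (L : Language) : Set where
  var : Var → Term L
  app : (f : F L) → Vec (Term L) (arity L f) → Term L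

data OccursT {L : Language} (x : Var) : Term L → Set where
  here : OccursT x (var x)
  arg  : ∀ {f ts} → Any (OccursT x) ts → OccursT x (app f ts)

data Query (L : Language) : Set where
  true  : Query L
  false : Query L
  _≐_   : Term L → Term L → Query L
  atom  : (p : P L) → Vec (Term L) (parity L p) → Query L
  _∧_   : Query L → Query L → Query L
  ex    : Var → Query L → Query L

size : ∀ {L} → Query L → ℕ
size true = 0
size false = 0
size (s ≐ t) = 0
size (atom p ts) = 1
size (Q₁ ∧ Q₂) = size Q₁ + size Q₂
size (ex x Q) = size Q

data FreeIn {L : Language} (x : Var) : Query L → Set where
  eqˡ  : ∀ {s t} → OccursT x s → FreeIn x (s ≐ t)
  eqʳ  : ∀ {s t} → OccursT x t → FreeIn x (s ≐ t)
  atm  : ∀ {p ts} → Any (OccursT x) ts → FreeIn x (atom p ts)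
  conjˡ : ∀ {Q₁ Q₂} → FreeIn x Q₁ → FreeIn x (Q₁ ∧ Q₂)
  conjʳ : ∀ {Q₁ Q₂} → FreeIn x Q₂ → FreeIn x (Q₁ ∧ Q₂)
  under : ∀ {y Q} → ¬ (x ≡ y) → FreeIn x Q → FreeIn x (ex y Q)

_⊇vars_ : ∀ {L} → Query L → Query L → Set
Q ⊇vars Q' = ∀ x → FreeIn x Q' → FreeIn x Q

-- Pre-interpretations (equality is interpreted as identity _≡_)

record PreInterp (L : Language) : Set₁ where
  field
    U   : Set
    fun : (f : F L) → Vec U (arity L f) → U

open PreInterp

Valuation : ∀ {L} → PreInterp L → Set
Valuation J = Var → U J

mutual
  eval : ∀ {L} (J : PreInterp L) → Valuation J → Term L → U J
  eval J h (var x) = h x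
  eval J h (app f ts) = fun J f (evals J h ts)

  evals : ∀ {L} (J : PreInterp L) → Valuation J → ∀ {n} → Vec (Term L) n → Vec (U J) n
  evals J h [] = []
  evals J h (t ∷ ts) = eval J h t ∷ evals J h ts

_[_↦_] : ∀ {A : Set} → (Var → A) → Var → A → (Var → A)
(h [ x ↦ d ]) y = if does (y ≟ x) then d else h y

-- J is a model of FEA(L): each axiom holds in J under every valuation.
record ModelFEA {L : Language} (J : PreInterp L) : Set where
  field
    fea-inj  : (f : F L) (ds es : Vec (U J) (arity L f)) →
               (fun J f ds ≡ fun J f es → ds ≡ es) × (ds ≡ es → fun J f ds ≡ fun J f es)
    fea-clash : (f g : F L) → ¬ (f ≡ g) →
                (ds : Vec (U J) (arity L f)) (es : Vec (U J) (arity L g)) →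
                ¬ (fun J f ds ≡ fun J g es)
    fea-occurs : (x : Var) (t : Term L) → ¬ (t ≡ var x) → OccursT x t →
                 (h : Valuation J) → ¬ (h x ≡ eval J h t)

NonTrivial : ∀ {L} → PreInterp L → Set
NonTrivial J = Σ (U J) (λ a → Σ (U J) (λ b → ¬ (a ≡ b)))

NonTrivialModelFEA : ∀ {L} → PreInterp L → Set
NonTrivialModelFEA J = ModelFEA J × NonTrivial J

Interp : ∀ {L} → PreInterp L → Set₁
Interp {L} J = (p : P L) → Vec (U J) (parity L p) → Set

-- Sol_J(Q, Ī), as a predicate on J-valuations
Sol : ∀ {L} (J : PreInterp L) (Q : Query L) → Vec (Interp J) (size Q) → Valuation J → Set
Sol J true Is h = ⊤
Sol J false Is h = ⊥
Sol J (s ≐ t) Is h = eval J h s ≡ eval J h t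
Sol J (atom p ts) (I ∷ []) h = I p (evals J h ts)
Sol J (Q₁ ∧ Q₂) Is h = Sol J Q₁ (take (size Q₁) Is) h × Sol J Q₂ (drop (size Q₁) Is) h
Sol J (ex x Q) Is h = Σ (U J) (λ d → Sol J Q Is (h [ x ↦ d ]))

record _≼[_]_ {L} (Q : Query L) (J : PreInterp L) (Q' : Query L) : Set₁ where
  field
    sameSize : size Q ≡ size Q'
    incl     : (Is : Vec (Interp J) (size Q)) (h : Valuation J) →
               Sol J Q Is h → Sol J Q' (subst (Vec (Interp J)) sameSize Is) h

Holds : ∀ {L} (J : PreInterp L) → Interp J → Query L → Valuation J → Set
Holds J I true h = ⊤
Holds J I false h = ⊥
Holds J I (s ≐ t) h = eval J h s ≡ eval J h t
Holds J I (atom p ts) h = I p (evals J h ts)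
Holds J I (Q₁ ∧ Q₂) h = Holds J I Q₁ h × Holds J I Q₂ h
Holds J I (ex x Q) h = Σ (U J) (λ d → Holds J I Q (h [ x ↦ d ]))

-- Q consistent:  FEA(L) ⊭ ¬Q, i.e. some model of FEA(L) satisfies Q
-- under some valuation.
Consistent : ∀ {L} → Query L → Set₁
Consistent {L} Q =
  Σ (PreInterp L) λ J → ModelFEA J ×
    Σ (Interp J) λ I → Σ (Valuation J) λ h → Holds J I Q h

Atom : Language → Set
Atom L = Σ (P L) (λ p → Vec (Term L) (parity L p))

conj : ∀ {L} → List (Query L) → Query L
conj [] = true
conj (c ∷ []) = c
conj (c ∷ c' ∷ cs) = c ∧ conj (c' ∷ cs)

exs : ∀ {L} → List Var → Query L → Query L
exs zs Q = foldr ex Q zs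

body : ∀ {L} → List (Var × Term L) → List (Atom L) → Query L
body eqs as = conj (map (λ e → var (proj₁ e) ≐ proj₂ e) eqs ++ map (λ a → atom (proj₁ a) (proj₂ a)) as)

record SolvedShape {L} (zs : List Var) (eqs : List (Var × Term L)) (as : List (Atom L)) : Set where
  field
    distinct   : Unique (zs ++ map proj₁ eqs)
    xNotInS    : ∀ {x} → x ∈ map proj₁ eqs → ∀ {e} → e ∈ eqs → ¬ OccursT x (proj₂ e)
    xNotInAtom : ∀ {x} → x ∈ map proj₁ eqs → ∀ {a} → a ∈ as → ¬ Any (OccursT x) (proj₂ a)
    zOccurs    : ∀ {z} → z ∈ zs → FreeIn z (body eqs as)
    zNotS      : ∀ {z} → z ∈ zs → ∀ {e} → e ∈ eqs → ¬ (proj₂ e ≡ var z)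

data SolvedForm {L} : Query L → Set where
  sf-true  : SolvedForm true
  sf-false : SolvedForm false
  sf-main  : (zs : List Var) (eqs : List (Var × Term L)) (as : List (Atom L)) →
             SolvedShape zs eqs as → SolvedForm (exs zs (body eqs as))

-- Suppose x is free in Q' but not in Q. Fix an element a and let g send every
-- variable to a, except that each left-hand side xᵢ of Q is sent to the value of
-- sᵢ; interpreting every atom occurrence A of Q by the single fact g(A), the
-- valuation g satisfies Q (the zⱼ are witnessed by their own g-values). As x is
-- not free in Q, every x-variant g[x ↦ e] satisfies Q, hence Q'. In Q' the
-- variable x occurs outside the quantifier prefix in an equation or an atom, and
-- the free equality axioms make its value rigid there: a term determines the
-- values of the variables occurring in it, an atom interpreted by one fact
-- determines its arguments, and x = f(t̄) confines x to the range of f, which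
-- misses either a constant or one of two distinct elements. Either way x cannot
-- take every value in a non-trivial model.
{-# OPTIONS --safe #-}
module Submission where

open import Defs
open import Data.Nat using (_≟_)
open import Data.Product using (∃; _×_; _,_; proj₁; proj₂; uncurry)
open import Data.Sum using (inj₁; inj₂; [_,_]′)
open import Data.List using (List; []; _∷_; _++_; map)
open import Data.List.Membership.Propositional using (_∈_)
open import Data.List.Membership.Propositional.Properties using (∈-map⁻; ∈-map⁺; ∈-++⁻; ∈-++⁺ʳ)
open import Data.List.Relation.Unary.Any using (here; there)
import Data.List.Relation.Unary.All as List
open import Data.List.Relation.Unary.AllPairs using (_∷_)
open import Data.List.Relation.Unary.Unique.Propositional using (Unique)
open import Data.Vec using (Vec; []; _∷_; take; drop; toList)
import Data.Vec as Vec
open import Data.Vec.Properties using (toList-injective; cast-is-id; take++drop≡id; ++-injective; ∷-injective)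
open import Data.Vec.Relation.Unary.Any as Any using (toSum; fromSum)
open import Data.Vec.Relation.Unary.All using (All; []; _∷_)
import Data.Vec.Relation.Unary.All.Properties as All
open import Data.Empty using (⊥-elim)
open import Data.Unit using (tt)
open import Relation.Nullary using (¬_; Dec; yes; no)
open import Relation.Nullary.Decidable using (dec-true; dec-false; map′; ¬?; _×-dec_; _⊎-dec_)
open import Relation.Binary.PropositionalEquality
open import Function using (_∘_)

open Language
open PreInterp
open ModelFEA
open SolvedShape
open _≼[_]_

update-same : ∀ {A : Set} (h : Var → A) x d → (h [ x ↦ d ]) x ≡ d
update-same h x d rewrite dec-true (x ≟ x) refl = refl

update-other : ∀ {A : Set} (h : Var → A) {x y} d → ¬ y ≡ x → (h [ x ↦ d ]) y ≡ h y
update-other h {x} {y} d y≢x rewrite dec-false (y ≟ x) y≢x = refl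

update-self : ∀ {A : Set} (h : Var → A) x y → (h [ x ↦ h x ]) y ≡ h y
update-self h x y with y ≟ x
... | yes refl = update-same h y (h y)
... | no y≢x = update-other h (h x) y≢x

update-cong : ∀ {A : Set} {h h' : Var → A} x d y → (¬ y ≡ x → h y ≡ h' y) →
              (h [ x ↦ d ]) y ≡ (h' [ x ↦ d ]) y
update-cong {h = h} {h'} x d y agree with y ≟ x
... | yes refl = trans (update-same h y d) (sym (update-same h' y d))
... | no y≢x = trans (update-other h d y≢x) (trans (agree y≢x) (sym (update-other h' d y≢x)))


mutual
  occurs? : ∀ {L} x (t : Term L) → Dec (OccursT x t)
  occurs? x (var y) = map′ (λ { refl → here }) (λ { here → refl }) (x ≟ y)
  occurs? x (app f ts) = map′ arg (λ { (arg o) → o }) (occursAny? x ts)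

  occursAny? : ∀ {L} x {n} (ts : Vec (Term L) n) → Dec (Any.Any (OccursT x) ts)
  occursAny? x [] = no λ ()
  occursAny? x (t ∷ ts) = map′ fromSum toSum (occurs? x t ⊎-dec occursAny? x ts)

freeIn? : ∀ {L} x (Q : Query L) → Dec (FreeIn x Q)
freeIn? x true = no λ ()
freeIn? x false = no λ ()
freeIn? x (s ≐ t) =
  map′ [ eqˡ , eqʳ ]′ (λ { (eqˡ o) → inj₁ o ; (eqʳ o) → inj₂ o }) (occurs? x s ⊎-dec occurs? x t)
freeIn? x (atom p ts) = map′ atm (λ { (atm o) → o }) (occursAny? x ts)
freeIn? x (Q₁ ∧ Q₂) =
  map′ [ conjˡ , conjʳ ]′ (λ { (conjˡ f) → inj₁ f ; (conjʳ f) → inj₂ f }) (freeIn? x Q₁ ⊎-dec freeIn? x Q₂)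
freeIn? x (ex y Q) = map′ (uncurry under) (λ { (under n f) → n , f }) (¬? (x ≟ y) ×-dec freeIn? x Q)

size-exs : ∀ {L} zs (B : Query L) → size (exs zs B) ≡ size B
size-exs [] B = refl
size-exs (z ∷ zs) B = size-exs zs B

freeIn-exs⁻ : ∀ {L} {x} zs (B : Query L) → FreeIn x (exs zs B) → ¬ x ∈ zs × FreeIn x B
freeIn-exs⁻ [] B f = (λ ()) , f
freeIn-exs⁻ (z ∷ zs) B (under x≢z f) with freeIn-exs⁻ zs B f
... | x∉zs , f' = (λ { (here x≡z) → x≢z x≡z ; (there x∈zs) → x∉zs x∈zs }) , f'

freeIn-conj⁻ : ∀ {L} {x} (cs : List (Query L)) → FreeIn x (conj cs) → ∃ λ c → c ∈ cs × FreeIn x c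
freeIn-conj⁻ (c ∷ []) f = c , here refl , f
freeIn-conj⁻ (c ∷ c' ∷ cs) (conjˡ f) = c , here refl , f
freeIn-conj⁻ (c ∷ c' ∷ cs) (conjʳ f) with freeIn-conj⁻ (c' ∷ cs) f
... | d , d∈ , f' = d , there d∈ , f'

conjuncts : ∀ {L} → List (Var × Term L) → List (Atom L) → List (Query L)
conjuncts eqs as = map (λ e → var (proj₁ e) ≐ proj₂ e) eqs ++ map (λ a → atom (proj₁ a) (proj₂ a)) as

Unique-++⁻ʳ : ∀ {A : Set} (xs : List A) {ys} → Unique (xs ++ ys) → Unique ys
Unique-++⁻ʳ [] u = u
Unique-++⁻ʳ (x ∷ xs) (_ ∷ u) = Unique-++⁻ʳ xs u

Unique-++-disjoint : ∀ {A : Set} (xs : List A) {ys y} → Unique (xs ++ ys) → y ∈ ys → ¬ y ∈ xs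
Unique-++-disjoint (x ∷ xs) {ys} (x∉ ∷ u) y∈ys (here refl) = List.lookup x∉ (∈-++⁺ʳ xs y∈ys) refl
Unique-++-disjoint (x ∷ xs) (_ ∷ u) y∈ys (there y∈xs) = Unique-++-disjoint xs u y∈ys y∈xs

All-subst : ∀ {a p} {A : Set a} {P : A → Set p} {m n} (m≡n : m ≡ n) {xs : Vec A m} →
            All P xs → All P (subst (Vec A) m≡n xs)
All-subst refl pxs = pxs

Vec-length-0-unique : ∀ {A : Set} {n} → n ≡ 0 → (u v : Vec A n) → u ≡ v
Vec-length-0-unique refl [] [] = refl

module _ {L : Language} (J : PreInterp L) where

  mutual
    eval-cong : ∀ {h h'} (t : Term L) → (∀ y → OccursT y t → h y ≡ h' y) → eval J h t ≡ eval J h' t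
    eval-cong (var y) agree = agree y here
    eval-cong (app f ts) agree = cong (fun J f) (evals-cong ts λ y o → agree y (arg o))

    evals-cong : ∀ {h h' n} (ts : Vec (Term L) n) → (∀ y → Any.Any (OccursT y) ts → h y ≡ h' y) →
                 evals J h ts ≡ evals J h' ts
    evals-cong [] agree = refl
    evals-cong (t ∷ ts) agree =
      cong₂ _∷_ (eval-cong t λ y o → agree y (Any.here o)) (evals-cong ts λ y o → agree y (Any.there o))

  Sol-cong : ∀ (Q : Query L) (Is : Vec (Interp J) (size Q)) {h h'} →
             (∀ y → FreeIn y Q → h y ≡ h' y) → Sol J Q Is h → Sol J Q Is h'
  Sol-cong true Is agree s = tt
  Sol-cong (s ≐ t) Is agree e =
    trans (sym (eval-cong s λ y o → agree y (eqˡ o))) (trans e (eval-cong t λ y o → agree y (eqʳ o)))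
  Sol-cong (atom p ts) (I ∷ []) agree s = subst (I p) (evals-cong ts λ y o → agree y (atm o)) s
  Sol-cong (Q₁ ∧ Q₂) Is agree (s₁ , s₂) =
    Sol-cong Q₁ _ (λ y f → agree y (conjˡ f)) s₁ , Sol-cong Q₂ _ (λ y f → agree y (conjʳ f)) s₂
  Sol-cong (ex x Q) Is {h} {h'} agree (d , s) =
    d , Sol-cong Q Is (λ y f → update-cong {h = h} {h'} x d y λ y≢x → agree y (under y≢x f)) s

  Sol-∧⁺ : ∀ Q₁ Q₂ {Is₁ Is₂ h} → Sol J Q₁ Is₁ h → Sol J Q₂ Is₂ h → Sol J (Q₁ ∧ Q₂) (Is₁ Vec.++ Is₂) h
  Sol-∧⁺ Q₁ Q₂ {Is₁} {Is₂} {h} s₁ s₂ =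
    subst (λ Is → Sol J Q₁ Is h) (sym take-++) s₁ , subst (λ Is → Sol J Q₂ Is h) (sym drop-++) s₂
    where
      Is = Is₁ Vec.++ Is₂
      split = ++-injective (take (size Q₁) Is) Is₁ (take++drop≡id (size Q₁) Is)
      take-++ = proj₁ split
      drop-++ = proj₂ split

  Sol-exs⁻ : ∀ zs (B : Query L) (Is : Vec (Interp J) (size (exs zs B))) h → Sol J (exs zs B) Is h →
             ∃ λ k → (∀ y → ¬ y ∈ zs → k y ≡ h y) × Sol J B (subst (Vec (Interp J)) (size-exs zs B) Is) k
  Sol-exs⁻ [] B Is h s = h , (λ _ _ → refl) , s
  Sol-exs⁻ (z ∷ zs) B Is h (d , s) with Sol-exs⁻ zs B Is (h [ z ↦ d ]) s
  ... | k , agree , s' =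
    k , (λ y y∉ → trans (agree y (λ y∈ → y∉ (there y∈))) (update-other h d (λ y≡z → y∉ (here y≡z)))) , s'

  Sol-conj⁻ : ∀ {P : Interp J → Set} (cs : List (Query L)) {c} → c ∈ cs →
              (Is : Vec (Interp J) (size (conj cs))) → All P Is →
              ∃ λ (Ic : Vec (Interp J) (size c)) → All P Ic × (∀ k → Sol J (conj cs) Is k → Sol J c Ic k)
  Sol-conj⁻ (c ∷ []) (here refl) Is pIs = Is , pIs , λ k s → s
  Sol-conj⁻ (c ∷ c' ∷ cs) (here refl) Is pIs = take (size c) Is , All.take⁺ (size c) pIs , λ k → proj₁
  Sol-conj⁻ (c ∷ c' ∷ cs) (there c∈) Is pIs
    with Sol-conj⁻ (c' ∷ cs) c∈ (drop (size c) Is) (All.drop⁺ (size c) pIs)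
  ... | Ic , pIc , sol = Ic , pIc , λ k s → sol k (proj₂ s)

  AtMostOne : Interp J → Set
  AtMostOne I = ∀ p {ds es} → I p ds → I p es → ds ≡ es

  -- Tuples are compared as lists since the arity of the predicate symbol may differ from n;
  -- the symbol itself is ignored, as each interpretation is consulted only at its own atom occurrence.
  pointInterp : ∀ {n} → Vec (U J) n → Interp J
  pointInterp us _ ds = toList ds ≡ toList us

  pointInterp-atMostOne : ∀ {n} (us : Vec (U J) n) → AtMostOne (pointInterp us)
  pointInterp-atMostOne us _ {ds} {es} ds≡us es≡us =
    trans (sym (cast-is-id refl ds)) (toList-injective refl ds es (trans ds≡us (sym es≡us)))

  pointInterps : Valuation J → (Q : Query L) → Vec (Interp J) (size Q)
  pointInterps g true = []
  pointInterps g false = []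
  pointInterps g (s ≐ t) = []
  pointInterps g (atom p ts) = pointInterp (evals J g ts) ∷ []
  pointInterps g (Q₁ ∧ Q₂) = pointInterps g Q₁ Vec.++ pointInterps g Q₂
  pointInterps g (ex x Q) = pointInterps g Q

  pointInterps-atMostOne : ∀ g Q → All AtMostOne (pointInterps g Q)
  pointInterps-atMostOne g true = []
  pointInterps-atMostOne g false = []
  pointInterps-atMostOne g (s ≐ t) = []
  pointInterps-atMostOne g (atom p ts) = pointInterp-atMostOne (evals J g ts) ∷ []
  pointInterps-atMostOne g (Q₁ ∧ Q₂) = All.++⁺ (pointInterps-atMostOne g Q₁) (pointInterps-atMostOne g Q₂)
  pointInterps-atMostOne g (ex x Q) = pointInterps-atMostOne g Q

  Sol-conj⁺ : ∀ g (cs : List (Query L)) → (∀ {c} → c ∈ cs → Sol J c (pointInterps g c) g) →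
              Sol J (conj cs) (pointInterps g (conj cs)) g
  Sol-conj⁺ g [] sol = tt
  Sol-conj⁺ g (c ∷ []) sol = sol (here refl)
  Sol-conj⁺ g (c ∷ c' ∷ cs) sol =
    Sol-∧⁺ c (conj (c' ∷ cs)) (sol (here refl)) (Sol-conj⁺ g (c' ∷ cs) (sol ∘ there))

  Sol-exs⁺ : ∀ g zs (B : Query L) → Sol J B (pointInterps g B) g →
             Sol J (exs zs B) (pointInterps g (exs zs B)) g
  Sol-exs⁺ g [] B s = s
  Sol-exs⁺ g (z ∷ zs) B s = g z , Sol-cong (exs zs B) _ (λ y _ → sym (update-self g z y)) (Sol-exs⁺ g zs B s)


module _ {L : Language} {J : PreInterp L} (M : ModelFEA J) where

  mutual
    eval-injectiveAt : ∀ {x k k'} (t : Term L) → OccursT x t → eval J k t ≡ eval J k' t → k x ≡ k' x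
    eval-injectiveAt (var y) here e = e
    eval-injectiveAt (app f ts) (arg o) e = evals-injectiveAt ts o (proj₁ (fea-inj M f _ _) e)

    evals-injectiveAt : ∀ {x k k' n} (ts : Vec (Term L) n) → Any.Any (OccursT x) ts →
                        evals J k ts ≡ evals J k' ts → k x ≡ k' x
    evals-injectiveAt (t ∷ ts) (Any.here o) e = eval-injectiveAt t o (proj₁ (∷-injective e))
    evals-injectiveAt (t ∷ ts) (Any.there o) e = evals-injectiveAt ts o (proj₂ (∷-injective e))

  fun-not-surjective : NonTrivial J → (f : F L) → ¬ (∀ e → ∃ λ ds → e ≡ fun J f ds)
  fun-not-surjective (a , b , a≢b) f onto with hasConstant L
  ... | c , c-nullary = fea-clash M c f c≢f _ (proj₁ (onto value-of-c)) (proj₂ (onto value-of-c))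
    where
      value-of-c : U J
      value-of-c = fun J c (subst (Vec (U J)) (sym c-nullary) [])

      c≢f : ¬ c ≡ f
      c≢f refl with onto a | onto b
      ... | dsa , a≡ | dsb , b≡ =
        a≢b (trans a≡ (trans (cong (fun J c) (Vec-length-0-unique c-nullary dsa dsb)) (sym b≡)))

module _ {L : Language} (J : PreInterp L) (a : U J) where

  solveEqs : List (Var × Term L) → Valuation J
  solveEqs [] _ = a
  solveEqs ((x , s) ∷ eqs) = solveEqs eqs [ x ↦ eval J (λ _ → a) s ]

  solveEqs-other : ∀ eqs {y} → ¬ y ∈ map proj₁ eqs → solveEqs eqs y ≡ a
  solveEqs-other [] y∉ = refl
  solveEqs-other ((x , s) ∷ eqs) y∉ =
    trans (update-other (solveEqs eqs) _ (λ y≡x → y∉ (here y≡x))) (solveEqs-other eqs (λ y∈ → y∉ (there y∈)))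

  solveEqs-lhs : ∀ eqs {x s} → Unique (map proj₁ eqs) → (x , s) ∈ eqs → solveEqs eqs x ≡ eval J (λ _ → a) s
  solveEqs-lhs ((x , s) ∷ eqs) u (here refl) = update-same (solveEqs eqs) x _
  solveEqs-lhs ((x₀ , s₀) ∷ eqs) (x₀∉ ∷ u) (there e∈) =
    trans (update-other (solveEqs eqs) _ (λ x≡x₀ → List.lookup x₀∉ (∈-map⁺ proj₁ e∈) (sym x≡x₀)))
          (solveEqs-lhs eqs u e∈)

  solvedForm-satisfiable : ∀ (Q : Query L) → Consistent Q → SolvedForm Q →
                           ∃ λ g → Sol J Q (pointInterps J g Q) g
  solvedForm-satisfiable .true _ sf-true = (λ _ → a) , tt
  solvedForm-satisfiable .false (_ , _ , _ , _ , ()) sf-false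
  solvedForm-satisfiable _ _ (sf-main zs eqs as sh) = g , Sol-exs⁺ J g zs _ (Sol-conj⁺ J g _ conjunct-holds)
    where
      g = solveEqs eqs

      conjunct-holds : ∀ {c} → c ∈ conjuncts eqs as → Sol J c (pointInterps J g c) g
      conjunct-holds c∈ with ∈-++⁻ (map _ eqs) c∈
      ... | inj₁ c∈eqs with ∈-map⁻ _ c∈eqs
      ...   | (x , s) , e∈ , refl =
              trans (solveEqs-lhs eqs (Unique-++⁻ʳ zs (distinct sh)) e∈)
                    (sym (eval-cong J s λ y y∈s → solveEqs-other eqs λ y∈lhs → xNotInS sh y∈lhs e∈ y∈s))
      conjunct-holds c∈ | inj₂ c∈as with ∈-map⁻ _ c∈as
      ...   | (p , ts) , _ , refl = refl

module Pinning {L : Language} {J : PreInterp L} (M : ModelFEA J) (nt : NonTrivial J)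
               (g : Valuation J) (x : Var) (zs : List Var) where

  -- k is a valuation witnessing the quantifier prefix zs over the x-variant g[x ↦ e].
  record Variant (e : U J) (k : Valuation J) : Set where
    field
      at-x  : k x ≡ e
      off-x : ∀ {y} → ¬ y ∈ zs → ¬ y ≡ x → k y ≡ g y
  open Variant

  Pinned : (c : Query L) → Vec (Interp J) (size c) → Set
  Pinned c Ic = ¬ (∀ e → ∃ λ k → Variant e k × Sol J c Ic k)

  record Rigid (c : Query L) (Ic : Vec (Interp J) (size c)) : Set where
    field
      x-fixed : ∀ {e e' k k'} → Variant e k → Variant e' k' → Sol J c Ic k → Sol J c Ic k' → k x ≡ k' x
  open Rigid

  rigid⇒pinned : ∀ {c Ic} → Rigid c Ic → Pinned c Ic
  rigid⇒pinned rigid variants =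
    let a , b , a≢b = nt
        _ , va , sa = variants a
        _ , vb , sb = variants b
    in a≢b (trans (sym (at-x va)) (trans (x-fixed rigid va vb sa sb) (at-x vb)))

  rigid-var-var : ∀ {y} → ¬ y ∈ zs → ¬ y ≡ x → Rigid (var x ≐ var y) []
  rigid-var-var {y} y∉zs y≢x .x-fixed {k = k} {k'} v v' s s' = begin
    k x   ≡⟨ s ⟩
    k y   ≡⟨ off-x v y∉zs y≢x ⟩
    g y   ≡⟨ sym (off-x v' y∉zs y≢x) ⟩
    k' y  ≡⟨ sym s' ⟩
    k' x  ∎
    where open ≡-Reasoning

  rigid-occurs-rhs : ∀ {xᵢ s} → ¬ xᵢ ∈ zs → ¬ xᵢ ≡ x → OccursT x s → Rigid (var xᵢ ≐ s) []
  rigid-occurs-rhs {xᵢ} {s} xᵢ∉zs xᵢ≢x x∈s .x-fixed {k = k} {k'} v v' sol sol' =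
    eval-injectiveAt M s x∈s (begin
      eval J k s   ≡⟨ sym sol ⟩
      k xᵢ         ≡⟨ off-x v xᵢ∉zs xᵢ≢x ⟩
      g xᵢ         ≡⟨ sym (off-x v' xᵢ∉zs xᵢ≢x) ⟩
      k' xᵢ        ≡⟨ sol' ⟩
      eval J k' s  ∎)
    where open ≡-Reasoning

  rigid-atom : ∀ {p ts I} → AtMostOne J I → Any.Any (OccursT x) ts → Rigid (atom p ts) (I ∷ [])
  rigid-atom {p} {ts} one x∈ts .x-fixed v v' s s' = evals-injectiveAt M ts x∈ts (one p s s')

  pinned-var-app : ∀ {f ts} → Pinned (var x ≐ app f ts) []
  pinned-var-app {f} {ts} variants =
    fun-not-surjective M nt f λ e → let k , v , s = variants e in evals J k ts , trans (sym (at-x v)) s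

  equation-pinned : ∀ {eqs as} → SolvedShape zs eqs as → ∀ {xᵢ} s → (xᵢ , s) ∈ eqs →
                    FreeIn x (var xᵢ ≐ s) → Pinned (var xᵢ ≐ s) []
  equation-pinned sh (var y) e∈ (eqˡ here) = rigid⇒pinned (rigid-var-var y∉zs y≢x)
    where
      y∉zs : ¬ y ∈ zs
      y∉zs y∈zs = zNotS sh y∈zs e∈ refl
      y≢x : ¬ y ≡ x
      y≢x refl = xNotInS sh (∈-map⁺ proj₁ e∈) e∈ here
  equation-pinned sh (app f ts) e∈ (eqˡ here) = pinned-var-app
  equation-pinned sh {xᵢ} s e∈ (eqʳ x∈s) = rigid⇒pinned (rigid-occurs-rhs xᵢ∉zs xᵢ≢x x∈s)
    where
      xᵢ∈lhs = ∈-map⁺ proj₁ e∈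
      xᵢ∉zs : ¬ xᵢ ∈ zs
      xᵢ∉zs = Unique-++-disjoint zs (distinct sh) xᵢ∈lhs
      xᵢ≢x : ¬ xᵢ ≡ x
      xᵢ≢x refl = xNotInS sh xᵢ∈lhs e∈ x∈s

  atom-pinned : ∀ {p ts} (Ic : Vec (Interp J) 1) → All (AtMostOne J) Ic → FreeIn x (atom p ts) →
                Pinned (atom p ts) Ic
  atom-pinned (I ∷ []) (one ∷ []) (atm x∈ts) = rigid⇒pinned (rigid-atom one x∈ts)

  conjunct-pinned : ∀ {eqs as} → SolvedShape zs eqs as → ∀ {c} → c ∈ conjuncts eqs as → FreeIn x c →
                    (Ic : Vec (Interp J) (size c)) → All (AtMostOne J) Ic → Pinned c Ic
  conjunct-pinned {eqs} sh c∈ x∈c Ic one-Ic with ∈-++⁻ (map _ eqs) c∈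
  ... | inj₁ c∈eqs with ∈-map⁻ _ c∈eqs
  ...   | (xᵢ , s) , e∈ , refl = equation-pinned sh s e∈ x∈c
  conjunct-pinned sh c∈ x∈c Ic one-Ic | inj₂ c∈as with ∈-map⁻ _ c∈as
  ...   | (p , ts) , _ , refl = atom-pinned Ic one-Ic x∈c

solvedForm-pinned : ∀ {L} {J : PreInterp L} → ModelFEA J → NonTrivial J → ∀ {x} (Q : Query L) → SolvedForm Q →
                    FreeIn x Q → (Is : Vec (Interp J) (size Q)) → All (AtMostOne J) Is →
                    (g : Valuation J) → ¬ (∀ e → Sol J Q Is (g [ x ↦ e ]))
solvedForm-pinned {J = J} M nt {x} _ (sf-main zs eqs as sh) x∈Q Is one-Is g sols
  with freeIn-exs⁻ zs (body eqs as) x∈Q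
... | x∉zs , x∈B with freeIn-conj⁻ (conjuncts eqs as) x∈B
... | c , c∈ , x∈c with Sol-conj⁻ J (conjuncts eqs as) c∈ _ (All-subst (size-exs zs (body eqs as)) one-Is)
... | Ic , one-Ic , sol-c = conjunct-pinned sh c∈ x∈c Ic one-Ic variants
  where
    open Pinning M nt g x zs

    variants : ∀ e → ∃ λ k → Variant e k × Sol J c Ic k
    variants e =
      let k , agree , sol-B = Sol-exs⁻ J zs (body eqs as) Is (g [ x ↦ e ]) (sols e) in
      k , record { at-x = trans (agree x x∉zs) (update-same g x e)
                 ; off-x = λ y∉zs y≢x → trans (agree _ y∉zs) (update-other g e y≢x) }
        , sol-c k sol-B

lemma4p5 : (L : Language) (J : PreInterp L) → NonTrivialModelFEA J →
           (Q Q' : Query L) → Consistent Q → Consistent Q' →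
           SolvedForm Q → SolvedForm Q' →
           Q ≼[ J ] Q' → Q ⊇vars Q'
lemma4p5 L J (M , nt@(a , _)) Q Q' Q-consistent _ Q-solved Q'-solved Q≼Q' x x∈Q' with freeIn? x Q
... | yes x∈Q = x∈Q
... | no x∉Q =
  ⊥-elim (solvedForm-pinned M nt Q' Q'-solved x∈Q' _ (All-subst (sameSize Q≼Q') (pointInterps-atMostOne J g Q))
                            g every-x-variant)
  where
    satisfiable = solvedForm-satisfiable J a Q Q-consistent Q-solved
    g = proj₁ satisfiable

    every-x-variant : ∀ e → Sol J Q' (subst (Vec (Interp J)) (sameSize Q≼Q') (pointInterps J g Q)) (g [ x ↦ e ])
    every-x-variant e =
      incl Q≼Q' _ _ (Sol-cong J Q _ (λ y y∈Q → sym (update-other g {x} e λ { refl → x∉Q y∈Q }))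
                                   (proj₂ satisfiable))
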